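{- Let $n\in\mathbb{N}$ with $n>1$. Then $h(n)=2\cdot\omega(n)+2$.
   Context: Let $p_1=2,p_2=3,p_3=5,\dots$ be the primes in increasing order and $p_n\#=\prod_{i=1}^n p_i$. For $N\in\mathbb{N}$, the Jacobsthal function $j(N)$ is the smallest $m\in\mathbb{N}$ such that every sequence of $m$ consecutive integers contains an integer coprime to $N$. Define $h(n)=j(p_n\#)$ and, for $n>1$, $\omega(n)=j(p_n\#/2)-1$ (equivalently, $\omega(n)$ is the greatest length of a sequence of consecutive integers each of which is divisible by one of the odd primes $p_2,\dots,p_n$). -}

module Defs where

open import Data.Nat using (ℕ; zero; suc; _+_; _*_; _∸_; _/_; _<_; _≤_)
open import Data.Nat.Primality using (Prime; prime?)
open import Data.List using (List; filter; upTo; length)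
open import Data.Nat.ListAction using (product)
open import Data.Integer as ℤ using (ℤ; +_)
open import Data.Integer.Coprimality using () renaming (Coprime to ℤCoprime)
open import Data.Product using (Σ; _×_; ∃-syntax)
open import Relation.Binary.PropositionalEquality using (_≡_)
open import Relation.Nullary using (¬_)

primesUpTo : ℕ → List ℕ
primesUpTo p = filter prime? (upTo (suc p))

-- p is the n-th prime (1-indexed: p₁ = 2, p₂ = 3, ...)
IsNthPrime : ℕ → ℕ → Set
IsNthPrime n p = Prime p × length (primesUpTo p) ≡ n

-- p_n# when p = p_n : product of all primes ≤ p
primorial : ℕ → ℕ
primorial p = product (primesUpTo p)

AllRunsHitCoprime : ℕ → ℕ → Set
AllRunsHitCoprime N m =
  ∀ (a : ℤ) → ∃[ i ] (i < m × ℤCoprime (a ℤ.+ + i) (+ N))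

IsJacobsthal : ℕ → ℕ → Set
IsJacobsthal N m = AllRunsHitCoprime N m × (∀ k → AllRunsHitCoprime N k → m ≤ k)

{-# OPTIONS --safe #-}
module Submission where

-- Write p_n# = 2M with M = 1 + 2t odd. Since 2(x + t + 1) = (1 + 2x) + M, the odd number 1 + 2x is
-- coprime to 2M exactly when x + t + 1 is coprime to M, while even numbers never are. The odd members
-- of 2j consecutive integers are 1 + 2x for j consecutive values of x, so runs of length j for M give
-- runs of length 2j for 2M, and runs of length h for 2M give runs of length ⌊h/2⌋ for M. Hence
-- j(2M) = 2 j(M), that is h(n) = 2 (ω(n) + 1).

open import Defs
open import Data.Nat.Base using (ℕ; zero; suc; _+_; _*_; _∸_; _/_; _≤_; _<_; z≤n; s≤s; NonZero)
open import Data.Nat.Properties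
  using (*-suc; *-comm; *-monoʳ-≤; +-monoˡ-<; ≤-trans; ≤-antisym; +-comm; *-identityʳ; *-assoc; module ≤-Reasoning)
open import Data.Nat.DivMod using (m*n/n≡m; /-monoˡ-≤; m/n*n≤m)
open import Data.Nat.Divisibility using (_∣_; divides; ∣-trans; m∣m*n; n∣m*n)
import Data.Nat.Coprimality as ℕ
open import Data.Nat.Primality using (Prime; prime?; prime[2]; prime⇒irreducible; euclidsLemma)
open import Data.Nat.ListAction using (product)
open import Data.Nat.ListAction.Properties using (product-++)
open import Data.List.Base using (filter; upTo; _++_; [_])
open import Data.List.Properties using (applyUpTo-∷ʳ; filter-++; filter-accept; filter-reject)
open import Data.Integer.Base as ℤ using (ℤ; +_; ∣_∣)
open import Data.Integer.DivMod using (_%ℕ_; _/ℕ_; n%ℕd<d; a≡a%ℕn+[a/ℕn]*n)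
open import Data.Integer.Properties using (abs-*; pos-*; +-assoc; *-distribˡ-+)
open import Data.Integer.Divisibility.Signed using (∣ᵤ⇒∣; ∣⇒∣ᵤ; ∣-refl; ∣m∣n⇒∣m+n; ∣m+n∣n⇒∣m; ∣m⇒∣m*n)
open import Data.Integer.Coprimality as ℤ using (Coprime)
open import Data.Integer.Tactic.RingSolver using (solve-∀)
open import Data.Product using (∃-syntax; _×_; _,_; proj₁)
open import Data.Sum using (inj₁; inj₂)
open import Data.Empty using (⊥-elim)
open import Function.Base using (_∘_; id)
open import Function.Bundles using (_⇔_; mk⇔; Equivalence)
open import Function.Properties.Equivalence using (⇔-setoid)
open import Level using (0ℓ)
open import Relation.Binary.PropositionalEquality using (_≡_; refl; sym; trans; cong; subst; module ≡-Reasoning)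
open import Relation.Nullary using (¬_; yes; no)
import Relation.Binary.Reasoning.Setoid as SetoidReasoning

data Parity : ℕ → Set where
  even : ∀ q → Parity (2 * q)
  odd  : ∀ q → Parity (suc (2 * q))

parity : ∀ n → Parity n
parity zero = even 0
parity (suc n) with parity n
... | even q = odd q
... | odd q  = subst Parity (*-suc 2 q) (even (suc q))

2∤1 : ¬ 2 ∣ 1
2∤1 (divides zero ())
2∤1 (divides (suc _) ())

Odd : ℕ → Set
Odd n = ∃[ t ] n ≡ suc (2 * t)

¬2∣⇒odd : ∀ {n} → ¬ 2 ∣ n → Odd n
¬2∣⇒odd {n} 2∤n with parity n
... | even q = ⊥-elim (2∤n (m∣m*n q))
... | odd q  = q , refl

m*n≤o⇒m≤o/n : ∀ m n {o} .{{_ : NonZero n}} → m * n ≤ o → m ≤ o / n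
m*n≤o⇒m≤o/n m n m*n≤o = subst (_≤ _ / n) (m*n/n≡m m n) (/-monoˡ-≤ n m*n≤o)

prime∤* : ∀ {p m n} → Prime p → ¬ p ∣ m → ¬ p ∣ n → ¬ p ∣ m * n
prime∤* {m = m} {n} pp p∤m p∤n p∣mn with euclidsLemma m n pp p∣mn
... | inj₁ p∣m = p∤m p∣m
... | inj₂ p∣n = p∤n p∣n

2∤prime[3+m] : ∀ {m} → Prime (3 + m) → ¬ 2 ∣ 3 + m
2∤prime[3+m] pr 2∣p with prime⇒irreducible pr 2∣p
... | inj₁ ()
... | inj₂ ()

primorial-suc : ∀ k → primorial (suc k) ≡ primorial k * product (filter prime? [ suc k ])
primorial-suc k = begin
  product (filter prime? (upTo (2 + k)))                  ≡⟨ cong (product ∘ filter prime?) (applyUpTo-∷ʳ id (suc k)) ⟨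
  product (filter prime? (upTo (suc k) ++ [ suc k ]))     ≡⟨ cong product (filter-++ prime? (upTo (suc k)) [ suc k ]) ⟩
  product (filter prime? (upTo (suc k)) ++ filter prime? [ suc k ]) ≡⟨ product-++ (filter prime? (upTo (suc k))) _ ⟩
  primorial k * product (filter prime? [ suc k ])          ∎
  where open ≡-Reasoning

primorial-suc-prime : ∀ {k} → Prime (suc k) → primorial (suc k) ≡ primorial k * suc k
primorial-suc-prime {k} pr = begin
  primorial (suc k)                                ≡⟨ primorial-suc k ⟩
  primorial k * product (filter prime? [ suc k ])  ≡⟨ cong (λ ps → primorial k * product ps) (filter-accept prime? pr) ⟩
  primorial k * (suc k * 1)                        ≡⟨ cong (primorial k *_) (*-identityʳ (suc k)) ⟩
  primorial k * suc k                              ∎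
  where open ≡-Reasoning

primorial-suc-¬prime : ∀ {k} → ¬ Prime (suc k) → primorial (suc k) ≡ primorial k
primorial-suc-¬prime {k} ¬pr = trans (primorial-suc k)
  (trans (cong (λ ps → primorial k * product ps) (filter-reject prime? ¬pr)) (*-identityʳ _))

primorial≡2*odd : ∀ m → ∃[ M ] primorial (2 + m) ≡ 2 * M × ¬ 2 ∣ M
primorial≡2*odd zero = 1 , refl , 2∤1
primorial≡2*odd (suc m) with primorial≡2*odd m | prime? (3 + m)
... | M , eq , 2∤M | yes pr = M * (3 + m) , primorial≡ , prime∤* prime[2] 2∤M (2∤prime[3+m] pr)
  where
  primorial≡ : primorial (3 + m) ≡ 2 * (M * (3 + m))
  primorial≡ = trans (primorial-suc-prime pr) (trans (cong (_* (3 + m)) eq) (*-assoc 2 M (3 + m)))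
... | M , eq , 2∤M | no ¬pr = M , trans (primorial-suc-¬prime ¬pr) eq , 2∤M

prime∤⇒coprime : ∀ {p n} → Prime p → ¬ p ∣ n → ℕ.Coprime p n
prime∤⇒coprime pp p∤n (d∣p , d∣n) with prime⇒irreducible pp d∣p
... | inj₁ d≡1 = d≡1
... | inj₂ refl = ⊥-elim (p∤n d∣n)

coprime-∣ˡ : ∀ {m n d} → ℕ.Coprime m n → d ∣ m → ℕ.Coprime d n
coprime-∣ˡ m⊥n d∣m (e∣d , e∣n) = m⊥n (∣-trans e∣d d∣m , e∣n)

coprime-*ˡ : ∀ {m n o} → ℕ.Coprime m o → ℕ.Coprime n o → ℕ.Coprime (m * n) o
coprime-*ˡ {m} m⊥o n⊥o {d} (d∣mn , d∣o) = n⊥o (ℕ.coprime-divisor d⊥m d∣mn , d∣o)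
  where
  d⊥m : ℕ.Coprime d m
  d⊥m (e∣d , e∣m) = m⊥o (e∣m , ∣-trans e∣d d∣o)

coprime-sym⇔ : ∀ {x y} → Coprime x y ⇔ Coprime y x
coprime-sym⇔ {x} {y} = mk⇔ (ℤ.sym {x} {y}) (ℤ.sym {y} {x})

coprime-*ˡ⇔ : ∀ {k m z} → Coprime k m → Coprime (k ℤ.* z) m ⇔ Coprime z m
coprime-*ˡ⇔ {k} {m} {z} k⊥m = mk⇔ to from
  where
  to : Coprime (k ℤ.* z) m → Coprime z m
  to kz⊥m = coprime-∣ˡ kz⊥m (subst (∣ z ∣ ∣_) (sym (abs-* k z)) (n∣m*n ∣ k ∣))
  from : Coprime z m → Coprime (k ℤ.* z) m
  from z⊥m = subst (λ n → ℕ.Coprime n ∣ m ∣) (sym (abs-* k z)) (coprime-*ˡ k⊥m z⊥m)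

coprime-+ʳ⇔ : ∀ {x m} → Coprime (x ℤ.+ m) m ⇔ Coprime x m
coprime-+ʳ⇔ {x} {m} = mk⇔ to from
  where
  to : Coprime (x ℤ.+ m) m → Coprime x m
  to x+m⊥m {d} (d∣x , d∣m) = x+m⊥m (∣⇒∣ᵤ (∣m∣n⇒∣m+n (∣ᵤ⇒∣ {+ d} {x} d∣x) (∣ᵤ⇒∣ {+ d} {m} d∣m)) , d∣m)
  from : Coprime x m → Coprime (x ℤ.+ m) m
  from x⊥m {d} (d∣x+m , d∣m) = x⊥m (∣⇒∣ᵤ (∣m+n∣n⇒∣m {+ d} {x} {m} (∣ᵤ⇒∣ {+ d} {x ℤ.+ m} d∣x+m) (∣ᵤ⇒∣ {+ d} {m} d∣m)) , d∣m)

coprime-2-odd : ∀ x → Coprime (+ 2) (+ 1 ℤ.+ + 2 ℤ.* x)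
coprime-2-odd x = prime∤⇒coprime prime[2] λ 2∣y →
  2∤1 (∣⇒∣ᵤ (∣m+n∣n⇒∣m {+ 2} {+ 1} {+ 2 ℤ.* x} (∣ᵤ⇒∣ {+ 2} {+ 1 ℤ.+ + 2 ℤ.* x} 2∣y) (∣m⇒∣m*n x ∣-refl)))

even-¬coprime-even : ∀ w n → ¬ Coprime (+ 2 ℤ.* w) (+ (2 * n))
even-¬coprime-even w n w⊥n with w⊥n (∣⇒∣ᵤ (∣m⇒∣m*n w (∣-refl {+ 2})) , m∣m*n n)
... | ()

odd-coprime⇔halved-coprime : ∀ {M t} → M ≡ suc (2 * t) → ∀ x →
  Coprime (+ 1 ℤ.+ + 2 ℤ.* x) (+ (2 * M)) ⇔ Coprime (x ℤ.+ + suc t) (+ M)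
odd-coprime⇔halved-coprime {t = t} refl x = begin
  Coprime y (+ (2 * M))                   ≡⟨ cong (Coprime y) (pos-* 2 M) ⟩
  Coprime y (+ 2 ℤ.* + M)                 ≈⟨ coprime-sym⇔ {y} {+ 2 ℤ.* + M} ⟩
  Coprime (+ 2 ℤ.* + M) y                 ≈⟨ coprime-*ˡ⇔ {+ 2} {y} {+ M} (coprime-2-odd x) ⟩
  Coprime (+ M) y                         ≈⟨ coprime-sym⇔ {+ M} {y} ⟩
  Coprime y (+ M)                         ≈⟨ coprime-+ʳ⇔ {y} {+ M} ⟨
  Coprime (y ℤ.+ + M) (+ M)               ≡⟨ cong (λ z → Coprime z (+ M)) y+M≡ ⟩
  Coprime (+ 2 ℤ.* (x ℤ.+ + suc t)) (+ M) ≈⟨ coprime-*ˡ⇔ {+ 2} {+ M} {x ℤ.+ + suc t} 2⊥M ⟩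
  Coprime (x ℤ.+ + suc t) (+ M)           ∎
  where
  open SetoidReasoning (⇔-setoid 0ℓ)
  M = suc (2 * t)
  y = + 1 ℤ.+ + 2 ℤ.* x
  M≡ : + M ≡ + 1 ℤ.+ + 2 ℤ.* + t
  M≡ = cong (ℤ._+_ (+ 1)) (pos-* 2 t)
  y+M≡ : y ℤ.+ + M ≡ + 2 ℤ.* (x ℤ.+ + suc t)
  y+M≡ = trans (cong (ℤ._+_ y) M≡) (odd+odd x (+ t))
    where
    odd+odd : ∀ x t → (+ 1 ℤ.+ + 2 ℤ.* x) ℤ.+ (+ 1 ℤ.+ + 2 ℤ.* t) ≡ + 2 ℤ.* (x ℤ.+ (+ 1 ℤ.+ t))
    odd+odd = solve-∀
  2⊥M : Coprime (+ 2) (+ M)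
  2⊥M = subst (Coprime (+ 2)) (sym M≡) (coprime-2-odd (+ t))

nearest-odd : ∀ a → ∃[ e ] ∃[ q ] e ≤ 1 × a ℤ.+ + e ≡ + 1 ℤ.+ + 2 ℤ.* q
nearest-odd a = from-remainder (a %ℕ 2) (a /ℕ 2) (n%ℕd<d a 2) (a≡a%ℕn+[a/ℕn]*n a 2)
  where
  from-remainder : ∀ r q → r < 2 → a ≡ + r ℤ.+ q ℤ.* + 2 → ∃[ e ] ∃[ q ] e ≤ 1 × a ℤ.+ + e ≡ + 1 ℤ.+ + 2 ℤ.* q
  from-remainder 0 q _ a≡ = 1 , q , s≤s z≤n , trans (cong (ℤ._+ + 1) a≡) (even+1 q)
    where
    even+1 : ∀ q → + 0 ℤ.+ q ℤ.* + 2 ℤ.+ + 1 ≡ + 1 ℤ.+ + 2 ℤ.* q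
    even+1 = solve-∀
  from-remainder 1 q _ a≡ = 0 , q , z≤n , trans (cong (ℤ._+ + 0) a≡) (odd+0 q)
    where
    odd+0 : ∀ q → + 1 ℤ.+ q ℤ.* + 2 ℤ.+ + 0 ≡ + 1 ℤ.+ + 2 ℤ.* q
    odd+0 = solve-∀
  from-remainder (suc (suc _)) _ (s≤s (s≤s ())) _

allRunsHitCoprime-double : ∀ {M j} → Odd M → AllRunsHitCoprime M j → AllRunsHitCoprime (2 * M) (2 * j)
allRunsHitCoprime-double {M} {j} (t , M≡) hit a with nearest-odd a
... | e , q , e≤1 , a+e≡ with hit (q ℤ.+ + suc t)
... | i , i<j , coprime = e + 2 * i , offset<2j , subst (λ y → Coprime y (+ (2 * M))) (sym offset≡) odd-coprime
  where
  odd-coprime : Coprime (+ 1 ℤ.+ + 2 ℤ.* (q ℤ.+ + i)) (+ (2 * M))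
  odd-coprime = Equivalence.from (odd-coprime⇔halved-coprime {t = t} M≡ (q ℤ.+ + i))
    (subst (λ y → Coprime y (+ M)) (swap q (+ suc t) (+ i)) coprime)
    where
    swap : ∀ q s i → q ℤ.+ s ℤ.+ i ≡ q ℤ.+ i ℤ.+ s
    swap = solve-∀

  offset≡ : a ℤ.+ + (e + 2 * i) ≡ + 1 ℤ.+ + 2 ℤ.* (q ℤ.+ + i)
  offset≡ = begin
    a ℤ.+ (+ e ℤ.+ + (2 * i))          ≡⟨ cong (λ n → a ℤ.+ (+ e ℤ.+ n)) (pos-* 2 i) ⟩
    a ℤ.+ (+ e ℤ.+ + 2 ℤ.* + i)        ≡⟨ +-assoc a (+ e) (+ 2 ℤ.* + i) ⟨
    a ℤ.+ + e ℤ.+ + 2 ℤ.* + i          ≡⟨ cong (λ n → n ℤ.+ + 2 ℤ.* + i) a+e≡ ⟩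
    + 1 ℤ.+ + 2 ℤ.* q ℤ.+ + 2 ℤ.* + i  ≡⟨ odd+even q (+ i) ⟩
    + 1 ℤ.+ + 2 ℤ.* (q ℤ.+ + i)        ∎
    where
    open ≡-Reasoning
    odd+even : ∀ q r → + 1 ℤ.+ + 2 ℤ.* q ℤ.+ + 2 ℤ.* r ≡ + 1 ℤ.+ + 2 ℤ.* (q ℤ.+ r)
    odd+even = solve-∀

  offset<2j : e + 2 * i < 2 * j
  offset<2j = begin-strict
    e + 2 * i  <⟨ +-monoˡ-< (2 * i) (s≤s e≤1) ⟩
    2 + 2 * i  ≡⟨ *-suc 2 i ⟨
    2 * suc i  ≤⟨ *-monoʳ-≤ 2 i<j ⟩
    2 * j      ∎
    where open ≤-Reasoning

allRunsHitCoprime-halve : ∀ {M h} → Odd M → AllRunsHitCoprime (2 * M) h → AllRunsHitCoprime M (h / 2)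
allRunsHitCoprime-halve {M} {h} (t , M≡) hit b with hit (+ 2 ℤ.* (b ℤ.- + suc t))
... | k , k<h , coprime with parity k
... | even i = ⊥-elim (even-¬coprime-even (c ℤ.+ + i) M (subst (λ y → Coprime y (+ (2 * M))) even≡ coprime))
  where
  c = b ℤ.- + suc t
  even≡ : + 2 ℤ.* c ℤ.+ + (2 * i) ≡ + 2 ℤ.* (c ℤ.+ + i)
  even≡ = trans (cong (ℤ._+_ (+ 2 ℤ.* c)) (pos-* 2 i)) (sym (*-distribˡ-+ (+ 2) c (+ i)))
... | odd i = i , i<h/2 , subst (λ y → Coprime y (+ M)) (unshift b (+ suc t) (+ i)) half-coprime
  where
  c = b ℤ.- + suc t
  odd≡ : + 2 ℤ.* c ℤ.+ + suc (2 * i) ≡ + 1 ℤ.+ + 2 ℤ.* (c ℤ.+ + i)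
  odd≡ = trans (cong (λ n → + 2 ℤ.* c ℤ.+ (+ 1 ℤ.+ n)) (pos-* 2 i)) (even+odd c (+ i))
    where
    even+odd : ∀ c r → + 2 ℤ.* c ℤ.+ (+ 1 ℤ.+ + 2 ℤ.* r) ≡ + 1 ℤ.+ + 2 ℤ.* (c ℤ.+ r)
    even+odd = solve-∀
  half-coprime : Coprime (c ℤ.+ + i ℤ.+ + suc t) (+ M)
  half-coprime = Equivalence.to (odd-coprime⇔halved-coprime {t = t} M≡ (c ℤ.+ + i))
    (subst (λ y → Coprime y (+ (2 * M))) odd≡ coprime)
  unshift : ∀ b s r → b ℤ.- s ℤ.+ r ℤ.+ s ≡ b ℤ.+ r
  unshift = solve-∀
  i<h/2 : i < h / 2
  i<h/2 = m*n≤o⇒m≤o/n (suc i) 2 (subst (λ n → suc (suc n) ≤ h) (*-comm 2 i) k<h)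

allRunsHitCoprime⇒0< : ∀ {N m} → AllRunsHitCoprime N m → 0 < m
allRunsHitCoprime⇒0< hit with hit (+ 0)
... | _ , i<m , _ = ≤-trans (s≤s z≤n) i<m

isJacobsthal-double : ∀ {M h j} → Odd M → IsJacobsthal (2 * M) h → IsJacobsthal M j → h ≡ 2 * j
isJacobsthal-double {h = h} odd-M (hit-h , h-least) (hit-j , j-least) = ≤-antisym
  (h-least _ (allRunsHitCoprime-double odd-M hit-j))
  (≤-trans (*-monoʳ-≤ 2 (j-least _ (allRunsHitCoprime-halve odd-M hit-h))) 2*[h/2]≤h)
  where
  2*[h/2]≤h : 2 * (h / 2) ≤ h
  2*[h/2]≤h = subst (_≤ h) (*-comm (h / 2) 2) (m/n*n≤m h 2)

corollary1p8 : ∀ (n p hn jn : ℕ) → 1 < n → IsNthPrime n p →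
    IsJacobsthal (primorial p) hn →
    IsJacobsthal (primorial p / 2) jn →
    hn ≡ 2 * (jn ∸ 1) + 2
corollary1p8 _ (suc (suc m)) hn jn _ _ jacobsthal-h jacobsthal-j
  with primorial≡2*odd m
... | M , primorial≡ , 2∤M = begin
  hn                ≡⟨ isJacobsthal-double (¬2∣⇒odd 2∤M) (subst (λ N → IsJacobsthal N hn) primorial≡ jacobsthal-h)
                                            (subst (λ N → IsJacobsthal N jn) half≡ jacobsthal-j) ⟩
  2 * jn            ≡⟨ double-pred (allRunsHitCoprime⇒0< (proj₁ jacobsthal-j)) ⟩
  2 * (jn ∸ 1) + 2  ∎
  where
  open ≡-Reasoning
  half≡ : primorial (2 + m) / 2 ≡ M
  half≡ = trans (cong (_/ 2) (trans primorial≡ (*-comm 2 M))) (m*n/n≡m M 2)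
  double-pred : ∀ {j} → 0 < j → 2 * j ≡ 2 * (j ∸ 1) + 2
  double-pred {suc k} _ = trans (*-suc 2 k) (+-comm 2 (2 * k))
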